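{- Let $S=\{s_1,\dots,s_t\}$ with $1<s_1<s_2<\dots<s_t$ integers and $\gcd(s_1,\dots,s_t)=1$. Then (i) every witness for $S$ is a counterexample for $S$; (ii) if a counterexample for $S$ exists, then the smallest counterexample is a witness for $S$.
   Context: $\langle S\rangle=\{\sum_i a_i s_i : a_i\in\mathbb{N}_0\}$. A representation of $k\in\langle S\rangle$ is a vector $(a_1,\dots,a_t)\in\mathbb{N}_0^t$ with $\sum_i a_i s_i=k$; its cost is $\sum_i a_i$; $\mathrm{MinCost}_S(k)$ is the minimum cost over all representations. The (generalized) greedy representation of $k\in\langle S\rangle$, $k>0$: set $r:=k$; for $i=t,\dots,1$ let $a_i$ be the largest integer $q\ge0$ with $r-qs_i\in\langle S\rangle$ and replace $r$ by $r-a_is_i$; $\mathrm{GreedyCost}_S(k)=\sum_i a_i$ (with $\mathrm{GreedyCost}_S(0)=0$). A counterexample for $S$ is $k\in\langle S\rangle$, $k>0$, with $\mathrm{MinCost}_S(k)<\mathrm{GreedyCost}_S(k)$. A witness for $S$ is an integer $k>0$, $k\in\langle S\rangle$, such that for some generator $s_i<k$ with $k-s_i\in\langle S\rangle$ one has $\mathrm{GreedyCost}_S(k)>\mathrm{GreedyCost}_S(k-s_i)+1$. -}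

module Defs where

open import Data.Nat using (ℕ; zero; suc; _+_; _*_; _∸_; _≤_; _<_)
open import Data.Nat.GCD using (gcd)
open import Data.Fin using (Fin; zero; suc; toℕ)
open import Data.Product using (Σ; ∃; _×_; _,_)
open import Relation.Nullary using (¬_)
open import Relation.Binary.PropositionalEquality using (_≡_)

-- The generating set S = {s_1,...,s_t} is given as s : Fin t → ℕ
-- (index i : Fin t corresponds to s_{i+1}).

∑ : ∀ {n} → (Fin n → ℕ) → ℕ
∑ {zero}  f = 0
∑ {suc n} f = f zero + ∑ (λ i → f (suc i))

gcdAll : ∀ {n} → (Fin n → ℕ) → ℕ
gcdAll {zero}  f = 0
gcdAll {suc n} f = gcd (f zero) (gcdAll (λ i → f (suc i)))

StrictlyIncreasing : ∀ {t} → (Fin t → ℕ) → Set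
StrictlyIncreasing {t} s = ∀ (i j : Fin t) → toℕ i < toℕ j → s i < s j

value : ∀ {t} → (Fin t → ℕ) → (Fin t → ℕ) → ℕ
value s a = ∑ (λ i → a i * s i)

cost : ∀ {t} → (Fin t → ℕ) → ℕ
cost a = ∑ a

IsRep : ∀ {t} → (Fin t → ℕ) → ℕ → (Fin t → ℕ) → Set
IsRep s k a = value s a ≡ k

InS : ∀ {t} → (Fin t → ℕ) → ℕ → Set
InS {t} s k = Σ (Fin t → ℕ) (λ a → IsRep s k a)

IsMinCost : ∀ {t} → (Fin t → ℕ) → ℕ → ℕ → Set
IsMinCost {t} s k m =
  (Σ (Fin t → ℕ) (λ a → IsRep s k a × cost a ≡ m)) ×
  (∀ (a : Fin t → ℕ) → IsRep s k a → m ≤ cost a)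

-- remainder r before the greedy step for index i (steps run i = t,...,1):
-- k - Σ_{j > i} a_j s_j
remBefore : ∀ {t} → (Fin t → ℕ) → ℕ → (Fin t → ℕ) → Fin t → ℕ
remBefore s k a i = k ∸ ∑ (λ j → later i j)
  where
    later : Fin _ → Fin _ → ℕ
    later i j with toℕ i Data.Nat.<? toℕ j
    ... | Relation.Nullary.yes _ = a j * s j
    ... | Relation.Nullary.no  _ = 0

-- "r - q s_i ∈ ⟨S⟩" (as an integer; negative numbers are never in ⟨S⟩)
OkStep : ∀ {t} → (Fin t → ℕ) → ℕ → ℕ → ℕ → Set
OkStep s r q si = (q * si ≤ r) × InS s (r ∸ q * si)

-- a is the output of the (generalized) greedy algorithm on k:
-- at each step i, a_i is the largest q ≥ 0 with r - q s_i ∈ ⟨S⟩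
IsGreedy : ∀ {t} → (Fin t → ℕ) → ℕ → (Fin t → ℕ) → Set
IsGreedy {t} s k a =
  ∀ (i : Fin t) →
    OkStep s (remBefore s k a i) (a i) (s i) ×
    (∀ (q : ℕ) → a i < q → ¬ OkStep s (remBefore s k a i) q (s i))

-- GreedyCost_S(k) = g   (for k = 0 the algorithm returns the zero vector, cost 0)
IsGreedyCost : ∀ {t} → (Fin t → ℕ) → ℕ → ℕ → Set
IsGreedyCost {t} s k g = Σ (Fin t → ℕ) (λ a → IsGreedy s k a × cost a ≡ g)

Counterexample : ∀ {t} → (Fin t → ℕ) → ℕ → Set
Counterexample s k =
  InS s k × 0 < k ×
  ∃ λ m → ∃ λ g → IsMinCost s k m × IsGreedyCost s k g × m < g

Witness : ∀ {t} → (Fin t → ℕ) → ℕ → Set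
Witness {t} s k =
  0 < k × InS s k ×
  Σ (Fin t) (λ i → s i < k × InS s (k ∸ s i) ×
    ∃ λ g → ∃ λ g' → IsGreedyCost s k g × IsGreedyCost s (k ∸ s i) g' × suc g' < g)

SmallestCounterexample : ∀ {t} → (Fin t → ℕ) → ℕ → Set
SmallestCounterexample s k = Counterexample s k × (∀ k' → k' < k → ¬ Counterexample s k')

{-# OPTIONS --safe #-}
-- Adding one coin s i to the greedy representation of k ∸ s i represents a witness k with
-- GreedyCost(k ∸ s i) + 1 < GreedyCost(k) coins. Conversely, removing a coin s j from a minimal
-- representation of the smallest counterexample k leaves k ∸ s j, which is not a counterexample;
-- it is not 0 either, because greedy represents a generator by itself. Hence
-- GreedyCost(k ∸ s j) ≤ MinCost(k ∸ s j) ≤ MinCost(k) − 1 < GreedyCost(k) − 1.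
-- Both directions need that greedy produces a representation at all: its final remainder lies
-- in ⟨S⟩ but admits no further coin, so it is 0.
module Submission where

open import Defs
open import Data.Nat using (ℕ; _<_)
open import Data.Fin using (Fin; zero)
open import Data.Product using (_×_)
open import Relation.Binary.PropositionalEquality using (_≡_)

open import Data.Bool using (if_then_else_)
open import Data.Empty using (⊥-elim)
open import Data.Fin using (suc; toℕ)
open import Data.Fin.Properties using (any?)
open import Data.Nat
  using (zero; suc; pred; _+_; _*_; _∸_; _≤_; _<?_; _≤?_; _≟_; z≤n; s≤s; z<s; s<s⁻¹; >-nonZero)
open import Data.Nat.Induction using (<-wellFounded)
open import Data.Nat.Properties
open import Algebra.Properties.CommutativeSemigroup +-commutativeSemigroup using (x∙yz≈y∙xz)
open import Data.Product using (Σ; ∃; ∃-syntax; _,_; proj₁; proj₂)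
open import Data.Sum using (inj₁; inj₂)
open import Data.Vec.Functional using (head; tail; _∷_; updateAt)
open import Data.Vec.Functional.Properties using (updateAt-updateAt-local; updateAt-id)
open import Function using (_∘_; id)
open import Induction.WellFounded using (Acc; acc)
open import Relation.Nullary using (Dec; yes; no; does; ¬_)
open import Relation.Nullary.Decidable using (map′; _×-dec_)
open import Relation.Unary using (Decidable)
open import Relation.Binary.PropositionalEquality
  using (_≗_; _≢_; refl; sym; trans; cong; cong₂; subst; module ≡-Reasoning)

m*n<n⇒m≡0 : ∀ m {n} → m * n < n → m ≡ 0
m*n<n⇒m≡0 zero    _   = refl
m*n<n⇒m≡0 (suc m) {n} m*n<n = ⊥-elim (<⇒≱ m*n<n (m≤m+n n (m * n)))

m∸[n+o]≡m∸o∸n : ∀ m n o → m ∸ (n + o) ≡ m ∸ o ∸ n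
m∸[n+o]≡m∸o∸n m n o = trans (cong (m ∸_) (+-comm n o)) (sym (∸-+-assoc m o n))

module _ {P : ℕ → Set} (P? : Decidable P) where

  leastSatisfying : ∀ {n} → P n → ∃[ m ] P m × (∀ {j} → P j → m ≤ j)
  leastSatisfying {n} = search (<-wellFounded n)
    where
    search : ∀ {n} → Acc _<_ n → P n → ∃[ m ] P m × (∀ {j} → P j → m ≤ j)
    search {n} (acc smaller) Pn with anyUpTo? P? n
    ... | yes (j , j<n , Pj) = search (smaller j<n) Pj
    ... | no ∄j<n            = n , Pn , λ {j} Pj → ≮⇒≥ λ j<n → ∄j<n (j , j<n , Pj)

  greatestUpTo : ∀ N → P 0 → ∃[ q ] P q × (∀ {j} → q < j → j ≤ N → ¬ P j)
  greatestUpTo zero    P0 = 0 , P0 , λ 0<j j≤0 → ⊥-elim (<⇒≱ 0<j j≤0)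
  greatestUpTo (suc N) P0 with P? (suc N) | greatestUpTo N P0
  ... | yes PN | _ = suc N , PN , λ N<j j≤N → ⊥-elim (<⇒≱ N<j j≤N)
  ... | no ¬PN | q , Pq , noneAbove = q , Pq , noneAbove′
    where
    noneAbove′ : ∀ {j} → q < j → j ≤ suc N → ¬ P j
    noneAbove′ q<j j≤1+N with m≤n⇒m<n∨m≡n j≤1+N
    ... | inj₁ j<1+N = noneAbove q<j (≤-pred j<1+N)
    ... | inj₂ refl  = ¬PN

∑-cong : ∀ {n} {f g : Fin n → ℕ} → f ≗ g → ∑ f ≡ ∑ g
∑-cong {zero}  f≗g = refl
∑-cong {suc n} f≗g = cong₂ _+_ (f≗g zero) (∑-cong (f≗g ∘ suc))

∑-zeros : ∀ {n} → ∑ {n} (λ _ → 0) ≡ 0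
∑-zeros {zero}  = refl
∑-zeros {suc n} = ∑-zeros {n}

∑-mono-≤ : ∀ {n} {f g : Fin n → ℕ} → (∀ i → f i ≤ g i) → ∑ f ≤ ∑ g
∑-mono-≤ {zero}  f≤g = z≤n
∑-mono-≤ {suc n} f≤g = +-mono-≤ (f≤g zero) (∑-mono-≤ (f≤g ∘ suc))

term≤∑ : ∀ {n} (f : Fin n → ℕ) i → f i ≤ ∑ f
term≤∑ f zero    = m≤m+n (f zero) _
term≤∑ f (suc i) = ≤-trans (term≤∑ (tail f) i) (m≤n+m _ (f zero))

∑≡0⇒terms≡0 : ∀ {n} {f : Fin n → ℕ} → ∑ f ≡ 0 → ∀ i → f i ≡ 0
∑≡0⇒terms≡0 {f = f} ∑f≡0 i = n≤0⇒n≡0 (subst (f i ≤_) ∑f≡0 (term≤∑ f i))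

∑-positive : ∀ {n} (f : Fin n → ℕ) → 0 < ∑ f → ∃[ i ] 0 < f i
∑-positive {suc n} f 0<∑f with f zero in f₀≡
... | suc _ = zero , subst (0 <_) (sym f₀≡) z<s
... | zero  = let i , 0<fᵢ = ∑-positive (tail f) 0<∑f in suc i , 0<fᵢ

∑-updateAt-suc : ∀ {n} (f : Fin n → ℕ) i → ∑ (updateAt f i suc) ≡ suc (∑ f)
∑-updateAt-suc f zero    = refl
∑-updateAt-suc f (suc i) = trans (cong (f zero +_) (∑-updateAt-suc (tail f) i)) (+-suc (f zero) _)

value-updateAt-suc : ∀ {t} (s a : Fin t → ℕ) i → value s (updateAt a i suc) ≡ s i + value s a
value-updateAt-suc s a zero    = +-assoc (s zero) (a zero * s zero) _
value-updateAt-suc s a (suc i) = begin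
  a zero * s zero + value (tail s) (updateAt (tail a) i suc)
    ≡⟨ cong (a zero * s zero +_) (value-updateAt-suc (tail s) (tail a) i) ⟩
  a zero * s zero + (s (suc i) + value (tail s) (tail a))
    ≡⟨ x∙yz≈y∙xz (a zero * s zero) (s (suc i)) _ ⟩
  s (suc i) + value s a ∎
  where open ≡-Reasoning

cost≤value : ∀ {t} {s : Fin t → ℕ} → (∀ i → 0 < s i) → ∀ a → cost a ≤ value s a
cost≤value pos a = ∑-mono-≤ λ i → m≤m*n (a i) _ {{>-nonZero (pos i)}}

removeCoinAt : ∀ {t} (s a : Fin t → ℕ) i → 0 < a i →
  value s a ≡ s i + value s (updateAt a i pred) × cost a ≡ suc (cost (updateAt a i pred))
removeCoinAt s a i 0<aᵢ =
  trans (∑-cong λ j → cong (_* s j) (sym (restored j))) (value-updateAt-suc s a′ i) ,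
  trans (∑-cong (sym ∘ restored)) (∑-updateAt-suc a′ i)
  where
  a′ : Fin _ → ℕ
  a′ = updateAt a i pred
  restored : updateAt a′ i suc ≗ a
  restored j = trans (updateAt-updateAt-local i {h = id} a (suc-pred (a i) {{>-nonZero 0<aᵢ}}) j)
                     (updateAt-id i a j)

RepOfCost : ∀ {t} → (Fin t → ℕ) → ℕ → ℕ → Set
RepOfCost {t} s k m = Σ (Fin t → ℕ) λ a → IsRep s k a × cost a ≡ m

module _ {t : ℕ} {s : Fin t → ℕ} where

  emptyRep : RepOfCost s 0 0
  emptyRep = (λ _ → 0) , ∑-zeros {t} , ∑-zeros {t}

  RepOfCost-zero : ∀ {k} → RepOfCost s k 0 → k ≡ 0
  RepOfCost-zero (a , refl , cost≡0) =
    trans (∑-cong λ i → cong (_* s i) (∑≡0⇒terms≡0 cost≡0 i)) (∑-zeros {t})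

  addCoin : ∀ i {k m} → RepOfCost s k m → RepOfCost s (s i + k) (suc m)
  addCoin i (a , refl , refl) = updateAt a i suc , value-updateAt-suc s a i , ∑-updateAt-suc a i

  removeCoin : ∀ {k m} → RepOfCost s k (suc m) → ∃[ i ] ∃[ k′ ] k ≡ s i + k′ × RepOfCost s k′ m
  removeCoin (a , refl , cost≡) with ∑-positive a (subst (0 <_) (sym cost≡) z<s)
  ... | i , 0<aᵢ with removeCoinAt s a i 0<aᵢ
  ...   | value≡ , cost≡′ =
    i , _ , value≡ , updateAt a i pred , refl , suc-injective (trans (sym cost≡′) cost≡)

  RepOfCost? : ∀ k m → Dec (RepOfCost s k m)
  RepOfCost? k zero    = map′ (λ { refl → emptyRep }) RepOfCost-zero (k ≟ 0)
  RepOfCost? k (suc m) =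
    map′ fromCoin toCoin (any? λ i → (s i ≤? k) ×-dec RepOfCost? (k ∸ s i) m)
    where
    fromCoin : ∃[ i ] s i ≤ k × RepOfCost s (k ∸ s i) m → RepOfCost s k (suc m)
    fromCoin (i , sᵢ≤k , rep) = subst (λ k → RepOfCost s k (suc m)) (m+[n∸m]≡n sᵢ≤k) (addCoin i rep)
    toCoin : RepOfCost s k (suc m) → ∃[ i ] s i ≤ k × RepOfCost s (k ∸ s i) m
    toCoin rep with removeCoin rep
    ... | i , k′ , refl , rep′ =
      i , m≤m+n (s i) k′ , subst (λ k → RepOfCost s k m) (sym (m+n∸m≡n (s i) k′)) rep′

  InS-+ : ∀ i {k} → InS s k → InS s (s i + k)
  InS-+ i (a , rep) = let a′ , rep′ , _ = addCoin i (a , rep , refl) in a′ , rep′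

  InS-0 : InS s 0
  InS-0 = (λ _ → 0) , ∑-zeros {t}

  InS-generator : ∀ i → InS s (s i)
  InS-generator i = subst (InS s) (+-identityʳ (s i)) (InS-+ i InS-0)

  InS? : (∀ i → 0 < s i) → Decidable (InS s)
  InS? pos k = map′ (λ (_ , _ , a , rep , _) → a , rep) viaCost (anyUpTo? (RepOfCost? k) (suc k))
    where
    viaCost : InS s k → ∃[ m ] m < suc k × RepOfCost s k m
    viaCost (a , rep) = cost a , s≤s (subst (cost a ≤_) rep (cost≤value pos a)) , a , rep , refl

minCost : ∀ {t} {s : Fin t → ℕ} {k} → InS s k → ∃ (IsMinCost s k)
minCost {s = s} {k} (a , rep) with leastSatisfying (RepOfCost? k) (a , rep , refl)
... | m , rep , least = m , rep , λ a′ rep′ → least (a′ , rep′ , refl)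

strictlyAbove : ∀ {t} → (Fin t → ℕ) → (Fin t → ℕ) → Fin t → Fin t → ℕ
strictlyAbove s a i j = if does (toℕ i <? toℕ j) then a j * s j else 0

-- remBefore sums a function local to its where-block; unifying with k ∸ ∑ f exposes it as f.
remBefore≡ : ∀ {t} (s : Fin t → ℕ) k a i → remBefore s k a i ≡ k ∸ ∑ (strictlyAbove s a i)
remBefore≡ {t} s k a i = trans (proj₂ summands) (cong (k ∸_) (∑-cong termwise))
  where
  summands : Σ (Fin t → ℕ) λ f → remBefore s k a i ≡ k ∸ ∑ f
  summands = _ , refl
  termwise : proj₁ summands ≗ strictlyAbove s a i
  termwise j with toℕ i <? toℕ j in i<?j
  ... | yes _ rewrite cong does i<?j = refl
  ... | no _  rewrite cong does i<?j = refl

remBefore-suc : ∀ {t} (s : Fin (suc t) → ℕ) k a i →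
  remBefore s k a (suc i) ≡ remBefore (tail s) k (tail a) i
remBefore-suc s k a i = trans (remBefore≡ s k a (suc i)) (sym (remBefore≡ (tail s) k (tail a) i))

module Greedy (P : ℕ → Set) where

  Admissible : ℕ → ℕ → ℕ → Set
  Admissible r u q = q * u ≤ r × P (r ∸ q * u)

  IsGreatestAdmissible : ℕ → ℕ → ℕ → Set
  IsGreatestAdmissible r u q = Admissible r u q × (∀ q′ → q < q′ → ¬ Admissible r u q′)

  IsGreedyFor : ∀ {n} → (Fin n → ℕ) → ℕ → (Fin n → ℕ) → Set
  IsGreedyFor u k c = ∀ i → IsGreatestAdmissible (remBefore u k c i) (u i) (c i)

  greedy-tail : ∀ {n} {u : Fin (suc n) → ℕ} {k c} →
    IsGreedyFor u k c → IsGreedyFor (tail u) k (tail c)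
  greedy-tail {u = u} {k} {c} greedy i =
    subst (λ r → IsGreatestAdmissible r (u (suc i)) (c (suc i))) (remBefore-suc u k c i) (greedy (suc i))

  greedy-∷ : ∀ {n} {u : Fin (suc n) → ℕ} {k c q} →
    IsGreatestAdmissible (k ∸ value (tail u) c) (head u) q → IsGreedyFor (tail u) k c →
    IsGreedyFor u k (q ∷ c)
  greedy-∷ top rest zero = top
  greedy-∷ {u = u} {k} {c} {q} top rest (suc i) =
    subst (λ r → IsGreatestAdmissible r (u (suc i)) (c i)) (sym (remBefore-suc u k (q ∷ c) i)) (rest i)

  greedy-remainder : ∀ {n} (u : Fin n → ℕ) {k c} → P k → IsGreedyFor u k c →
    value u c ≤ k × P (k ∸ value u c)
  greedy-remainder {zero}  u Pk _ = z≤n , Pk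
  greedy-remainder {suc n} u {k} {c} Pk greedy
    with greedy-remainder (tail u) Pk (greedy-tail greedy) | greedy zero
  ... | V≤k , _ | (taken≤r , Pleft) , _ =
    ≤-trans (+-monoˡ-≤ V taken≤r) (≤-reflexive (m∸n+n≡m V≤k)) ,
    subst P (sym (m∸[n+o]≡m∸o∸n k (c zero * u zero) V)) Pleft
    where
    V : ℕ
    V = value (tail u) (tail c)

  ClosedUnder : ℕ → Set
  ClosedUnder u = ∀ {y} → P y → P (u + y)

  closedUnder-multiple : ∀ {u} → ClosedUnder u → ∀ q {y} → P y → P (q * u + y)
  closedUnder-multiple         closed zero    Py = Py
  closedUnder-multiple {u} closed (suc q) {y} Py =
    subst P (sym (+-assoc u (q * u) y)) (closed (closedUnder-multiple closed q Py))

  admissible-suc : ∀ {r u q y} → q * u ≤ r → r ∸ q * u ≡ u + y → P y → Admissible r u (suc q)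
  admissible-suc {r} {u} {q} {y} qu≤r left≡ Py = u+qu≤r , subst P (sym left′≡y) Py
    where
    open ≤-Reasoning
    u+qu≤r : u + q * u ≤ r
    u+qu≤r = begin
      u + q * u         ≤⟨ +-monoˡ-≤ (q * u) (subst (u ≤_) (sym left≡) (m≤m+n u y)) ⟩
      r ∸ q * u + q * u ≡⟨ m∸n+n≡m qu≤r ⟩
      r                 ∎
    left′≡y : r ∸ (u + q * u) ≡ y
    left′≡y = begin-equality
      r ∸ (u + q * u)   ≡⟨ m∸[n+o]≡m∸o∸n r u (q * u) ⟩
      r ∸ q * u ∸ u     ≡⟨ cong (_∸ u) left≡ ⟩
      u + y ∸ u         ≡⟨ m+n∸m≡n u y ⟩
      y                 ∎

  -- Taking the coin u j as well would contradict the maximality of the step at index j.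
  greedy-remainder-irreducible : ∀ {n} (u : Fin n → ℕ) {k c} → (∀ j → ClosedUnder (u j)) →
    IsGreedyFor u k c → ∀ j {y} → P y → k ∸ value u c ≢ u j + y
  greedy-remainder-irreducible u {k} {c} closed greedy zero Py R≡ =
    proj₂ (greedy zero) (suc (c zero)) ≤-refl
      (admissible-suc {q = c zero} (proj₁ (proj₁ (greedy zero))) left≡ Py)
    where
    left≡ : k ∸ value (tail u) (tail c) ∸ c zero * u zero ≡ u zero + _
    left≡ = trans (sym (m∸[n+o]≡m∸o∸n k (c zero * u zero) (value (tail u) (tail c)))) R≡
  greedy-remainder-irreducible u {k} {c} closed greedy (suc j) {y} Py R≡ =
    greedy-remainder-irreducible (tail u) (closed ∘ suc) (greedy-tail greedy) j
      (closedUnder-multiple (closed zero) (c zero) Py) r≡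
    where
    open ≡-Reasoning
    V taken : ℕ
    V = value (tail u) (tail c)
    taken = c zero * u zero
    r≡ : k ∸ V ≡ u (suc j) + (taken + y)
    r≡ = begin
      k ∸ V                    ≡⟨ sym (m+[n∸m]≡n (proj₁ (proj₁ (greedy zero)))) ⟩
      taken + (k ∸ V ∸ taken)  ≡⟨ cong (taken +_) (trans (sym (m∸[n+o]≡m∸o∸n k taken V)) R≡) ⟩
      taken + (u (suc j) + y)  ≡⟨ x∙yz≈y∙xz taken (u (suc j)) y ⟩
      u (suc j) + (taken + y)  ∎

  module _ (P? : Decidable P) where

    Admissible? : ∀ r u → Decidable (Admissible r u)
    Admissible? r u q = (q * u ≤? r) ×-dec P? (r ∸ q * u)

    greatestAdmissible : ∀ {r u} → 0 < u → P r → ∃ (IsGreatestAdmissible r u)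
    greatestAdmissible {r} {u} 0<u Pr with greatestUpTo (Admissible? r u) r (z≤n , Pr)
    ... | q , admissible , noneUpToR = q , admissible , λ q′ q<q′ admissible′ →
      noneUpToR q<q′ (≤-trans (m≤m*n q′ u {{>-nonZero 0<u}}) (proj₁ admissible′)) admissible′

    greedy-exists : ∀ {n} (u : Fin n → ℕ) → (∀ i → 0 < u i) → ∀ {k} → P k → ∃ (IsGreedyFor u k)
    greedy-exists {zero}  u _   _  = (λ ()) , λ ()
    greedy-exists {suc n} u pos Pk with greedy-exists (tail u) (pos ∘ suc) Pk
    ... | c , greedy with greatestAdmissible (pos zero) (proj₂ (greedy-remainder (tail u) Pk greedy))
    ...   | q , top = q ∷ c , greedy-∷ top greedy

module _ {t : ℕ} {s : Fin t → ℕ} where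
  open Greedy (InS s)

  greedy-value : ∀ {k b} → InS s k → IsGreedy s k b → value s b ≡ k
  greedy-value {k} {b} Ink greedy with greedy-remainder s Ink greedy
  ... | V≤k , (a , rep) with cost a in cost≡
  ...   | zero  = ≤-antisym V≤k (m∸n≡0⇒m≤n (RepOfCost-zero (a , rep , cost≡)))
  ...   | suc _ with removeCoin (a , rep , cost≡)
  ...     | i , _ , R≡ , (a′ , rep′ , _) =
    ⊥-elim (greedy-remainder-irreducible s InS-+ greedy i (a′ , rep′) R≡)

  greedy-takes-generator : StrictlyIncreasing s → ∀ {j b} → IsGreedy s (s j) b → 0 < b j
  greedy-takes-generator increasing {j} {b} greedy =
    ≮⇒≥ λ bⱼ<1 →
      proj₂ (greedy j) 1 bⱼ<1 (subst (λ r → Admissible r (s j) 1) (sym rⱼ≡sⱼ) takeOne)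
    where
    nothingAbove : ∀ x → strictlyAbove s b j x ≡ 0
    nothingAbove x with toℕ j <? toℕ x in j<?x
    ... | no _    rewrite cong does j<?x = refl
    ... | yes j<x rewrite cong does j<?x = cong (_* s x) (m*n<n⇒m≡0 (b x) (begin-strict
      b x * s x  ≤⟨ term≤∑ (λ i → b i * s i) x ⟩
      value s b  ≡⟨ greedy-value (InS-generator j) greedy ⟩
      s j        <⟨ increasing j x j<x ⟩
      s x        ∎))
      where open ≤-Reasoning
    rⱼ≡sⱼ : remBefore s (s j) b j ≡ s j
    rⱼ≡sⱼ = trans (remBefore≡ s (s j) b j) (cong (s j ∸_) (trans (∑-cong nothingAbove) (∑-zeros {t})))
    takeOne : Admissible (s j) (s j) 1
    takeOne = ≤-reflexive (*-identityˡ (s j)) ,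
              subst (InS s) (sym (trans (cong (s j ∸_) (*-identityˡ (s j))) (n∸n≡0 (s j)))) InS-0

  greedyCost-generator : StrictlyIncreasing s → (∀ i → 0 < s i) →
    ∀ {j b} → IsGreedy s (s j) b → cost b ≡ 1
  greedyCost-generator increasing pos {j} {b} greedy
    with removeCoinAt s b j (greedy-takes-generator increasing greedy)
  ... | value≡ , cost≡ =
    trans cost≡ (cong suc (n≤0⇒n≡0 (≤-trans (cost≤value pos _) (≤-reflexive rest≡0))))
    where
    rest≡0 : value s (updateAt b j pred) ≡ 0
    rest≡0 = +-cancelˡ-≡ (s j) _ _
      (trans (sym value≡) (trans (greedy-value (InS-generator j) greedy) (sym (+-identityʳ (s j)))))

  minCost≤ : ∀ {k m c} → IsMinCost s k m → RepOfCost s k c → m ≤ c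
  minCost≤ (_ , least) (a , rep , refl) = least a rep

  notCounterexample⇒greedyCost≤ : ∀ {k g c} → ¬ Counterexample s k → 0 < k →
    IsGreedyCost s k g → RepOfCost s k c → g ≤ c
  notCounterexample⇒greedyCost≤ ¬counter 0<k greedyK rep@(a , isRep , _) with minCost (a , isRep)
  ... | m , isMin = ≤-trans (≮⇒≥ λ m<g → ¬counter ((a , isRep) , 0<k , m , _ , isMin , greedyK , m<g))
                            (minCost≤ isMin rep)

  generator-not-counterexample : StrictlyIncreasing s → (∀ i → 0 < s i) →
    ∀ j → ¬ Counterexample s (s j)
  generator-not-counterexample _ pos j (_ , _ , zero , _ , (rep , _) , _) =
    <⇒≢ (pos j) (sym (RepOfCost-zero rep))
  generator-not-counterexample increasing pos j (_ , _ , suc m , _ , _ , (b , greedy , refl) , m<g) =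
    n≮0 (s<s⁻¹ (subst (suc m <_) (greedyCost-generator increasing pos greedy) m<g))

  witness⇒counterexample : ∀ k → Witness s k → Counterexample s k
  witness⇒counterexample k
    (0<k , Ink , i , sᵢ<k , Ink∸sᵢ , g , _ , greedyK , (b′ , greedy′ , refl) , 1+g′<g) with minCost Ink
  ... | m , isMin = Ink , 0<k , m , g , isMin , greedyK , ≤-<-trans (minCost≤ isMin oneMoreCoin) 1+g′<g
    where
    oneMoreCoin : RepOfCost s k (suc (cost b′))
    oneMoreCoin = subst (λ k → RepOfCost s k (suc (cost b′))) (m+[n∸m]≡n (<⇒≤ sᵢ<k))
                        (addCoin i (b′ , greedy-value Ink∸sᵢ greedy′ , refl))

  smallestCounterexample⇒witness : StrictlyIncreasing s → (∀ i → 0 < s i) →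
    ∀ k → SmallestCounterexample s k → Witness s k
  smallestCounterexample⇒witness _ _ _ ((_ , 0<k , zero , _ , (rep , _) , _) , _) =
    ⊥-elim (<⇒≢ 0<k (sym (RepOfCost-zero rep)))
  smallestCounterexample⇒witness increasing pos _
    (counter@(Ink , 0<k , suc m , g , (rep , _) , greedyK , m<g) , noSmaller) with removeCoin rep
  ... | j , zero , refl , _ =
    ⊥-elim (generator-not-counterexample increasing pos j
              (subst (Counterexample s) (+-identityʳ (s j)) counter))
  ... | j , k′@(suc _) , refl , rep′@(a′ , isRep′ , _)
    with greedy-exists (InS? pos) s pos (a′ , isRep′)
  ...   | b′ , greedy′ =
    0<k , Ink , j , m<m+n (s j) z<s , subst (InS s) (sym k∸sⱼ≡k′) (a′ , isRep′) ,
    g , cost b′ , greedyK ,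
    subst (λ x → IsGreedyCost s x (cost b′)) (sym k∸sⱼ≡k′) (b′ , greedy′ , refl) ,
    ≤-<-trans (s≤s g′≤m) m<g
    where
    k∸sⱼ≡k′ : s j + k′ ∸ s j ≡ k′
    k∸sⱼ≡k′ = m+n∸m≡n (s j) k′
    g′≤m : cost b′ ≤ m
    g′≤m = notCounterexample⇒greedyCost≤ (noSmaller k′ (m<n+m k′ (pos j))) z<s
                                         (b′ , greedy′ , refl) rep′

lemma3 : ∀ {t : ℕ} (s : Fin t → ℕ) →
    StrictlyIncreasing s → (∀ (i : Fin t) → 1 < s i) → gcdAll s ≡ 1 →
    (∀ (k : ℕ) → Witness s k → Counterexample s k) ×
    (∀ (k₀ : ℕ) → SmallestCounterexample s k₀ → Witness s k₀)
lemma3 s increasing 1<s _ =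
  witness⇒counterexample , smallestCounterexample⇒witness increasing (<⇒≤ ∘ 1<s)
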